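{- Let $r$ be an integer and let $(a_n)_{n\ge 0}$ be the sequence whose exponential generating function is $I_0(2\sqrt{r}\,x)$, i.e. $\sum_{n\ge0}a_n\frac{x^n}{n!}=\sum_{m\ge 0}\frac{r^m x^{2m}}{(m!)^2}$ (so $a_{2m}=\binom{2m}{m}r^m$ and $a_{2m+1}=0$). Then the Hankel transform of $(a_n)$ is $h_n=2^n r^{\binom{n+1}{2}}$ for all $n\ge 0$.
   Context: $I_0$ denotes the modified Bessel function of the first kind of order $0$, $I_0(z)=\sum_{m\ge0}\frac{(z/2)^{2m}}{(m!)^2}$. The Hankel transform of a sequence $(a_n)_{n\ge 0}$ is the sequence $(h_n)_{n\ge 0}$ with $h_n=\det\big(a_{i+j}\big)_{0\le i,j\le n}$. The convention $0^0=1$ is used. -}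

module Defs where

open import Data.Nat as ℕ using (ℕ; zero; suc)
open import Data.Nat.Combinatorics using (_C_)
open import Data.Integer as ℤ using (ℤ; +_; _*_; _+_; -_; _^_)
open import Data.Fin using (Fin; zero; suc; toℕ; punchIn)

∑ : (n : ℕ) → (Fin n → ℤ) → ℤ
∑ zero    f = + 0
∑ (suc n) f = f zero + ∑ n (λ i → f (suc i))

sgn : ℕ → ℤ
sgn zero    = + 1
sgn (suc k) = - sgn k

det : (n : ℕ) → (Fin n → Fin n → ℤ) → ℤ
det zero    M = + 1
det (suc n) M = ∑ (suc n) (λ j →
  sgn (toℕ j) * (M zero j * det n (λ i k → M (suc i) (punchIn j k))))

hankel : (ℕ → ℤ) → ℕ → ℤ
hankel a n = det (suc n) (λ i j → a (toℕ i ℕ.+ toℕ j))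

-- n! times the coefficient of x^n in I₀(2√r x) = ∑_m r^m x^{2m}/(m!)^2:
-- a_{2m} = (2m choose m) r^m, a_{2m+1} = 0.
besselSeq : ℤ → ℕ → ℤ
besselSeq r n with n ℕ.% 2
... | zero  = + ((2 ℕ.* (n ℕ./ 2)) C (n ℕ./ 2)) * (r ^ (n ℕ./ 2))
... | suc _ = + 0

{-# OPTIONS --safe #-}
module Submission where

-- The sequence is the first column of the Stieltjes table L of the coefficients α₀ = 2r,
-- αₖ = r (k ≥ 1): L(0,k) = δ₀ₖ and L(i+1,k) = L(i,k-1) + αₖ L(i,k+1). One checks
-- L(k+2t,k) = C(k+2t,t) rᵗ and L(k+2t+1,k) = 0, so L(n,0) = aₙ. With Dₖ = α₀⋯αₖ₋₁ the
-- recurrence makes Σₖ L(i,k) Dₖ L(j,k) invariant under (i+1, j) ↦ (i, j+1), so the Hankel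
-- matrix is L D Lᵀ. As L is lower unitriangular, subtracting row combinations turns it into
-- the upper triangular D Lᵀ, and hₙ = D₀⋯Dₙ = 2ⁿ r^C(n+1,2). These row operations are
-- justified from the first-row Laplace expansion: it is linear in every row, and it is
-- alternating by the double expansion along rows 0 and 1.

open import Defs
open import Data.Fin using (Fin; zero; suc; toℕ; fromℕ<; punchIn; _≟_)
open import Data.Fin.Properties using (suc-injective; toℕ-injective; toℕ<n; toℕ-fromℕ<)
open import Data.Integer using (ℤ; +_; -_; _+_; _*_; _^_)
import Data.Integer.Properties as ℤₚ
open import Data.Integer.Tactic.RingSolver using (solve-∀)
open import Data.Nat as ℕ using (ℕ; zero; suc; _<_; _<?_; s≤s; z≤n)
import Data.Nat.Properties as ℕₚ
import Data.Nat.Tactic.RingSolver as ℕ-Ring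
open import Data.Nat.Combinatorics using (_C_; nCk+nC[k+1]≡[n+1]C[k+1]; nCk≡nC[n∸k]; nC1≡n)
open import Data.Nat.DivMod using (_%_; _/_; m%n<n; m≡m%n+[m/n]*n)
open import Data.Sum using (inj₁; inj₂)
open import Data.Vec.Functional using (updateAt; zipWith)
open import Data.Vec.Functional.Properties
  using (updateAt-updates; updateAt-minimal; updateAt-id-local; updateAt-commutes)
open import Function using (_∘_; const)
open import Relation.Binary.Definitions using (tri<; tri≈; tri>)
open import Relation.Binary.PropositionalEquality
open import Relation.Nullary using (¬_; yes; no; contradiction)
open import Algebra.Properties.AbelianGroup ℤₚ.+-0-abelianGroup using (inverseʳ-unique)
open import Algebra.Properties.CommutativeSemigroup ℤₚ.+-commutativeSemigroup using (interchange)

open ≡-Reasoning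

-- Finite sums and products

∑-cong : ∀ n {f g : Fin n → ℤ} → f ≗ g → ∑ n f ≡ ∑ n g
∑-cong zero    f≗g = refl
∑-cong (suc n) f≗g = cong₂ _+_ (f≗g zero) (∑-cong n (f≗g ∘ suc))

∑-zero : ∀ n {f : Fin n → ℤ} → (∀ i → f i ≡ + 0) → ∑ n f ≡ + 0
∑-zero zero    f≡0 = refl
∑-zero (suc n) f≡0 = cong₂ _+_ (f≡0 zero) (∑-zero n (f≡0 ∘ suc))

∑-distrib-+ : ∀ n (f g : Fin n → ℤ) → ∑ n (λ i → f i + g i) ≡ ∑ n f + ∑ n g
∑-distrib-+ zero    f g = refl
∑-distrib-+ (suc n) f g =
  trans (cong (_+_ (f zero + g zero)) (∑-distrib-+ n (f ∘ suc) (g ∘ suc)))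
        (interchange (f zero) (g zero) (∑ n (f ∘ suc)) (∑ n (g ∘ suc)))

*-distribˡ-∑ : ∀ n c (f : Fin n → ℤ) → c * ∑ n f ≡ ∑ n (λ i → c * f i)
*-distribˡ-∑ zero    c f = ℤₚ.*-zeroʳ c
*-distribˡ-∑ (suc n) c f =
  trans (ℤₚ.*-distribˡ-+ c (f zero) (∑ n (f ∘ suc)))
        (cong (_+_ (c * f zero)) (*-distribˡ-∑ n c (f ∘ suc)))

∑-linear : ∀ n c (f g : Fin n → ℤ) → ∑ n (λ i → c * f i + g i) ≡ c * ∑ n f + ∑ n g
∑-linear n c f g = trans (∑-distrib-+ n _ g) (cong (_+ ∑ n g) (sym (*-distribˡ-∑ n c f)))

∑-single : ∀ n (f : Fin n → ℤ) t → (∀ k → k ≢ t → f k ≡ + 0) → ∑ n f ≡ f t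
∑-single (suc n) f zero    f≡0 =
  trans (cong (_+_ (f zero)) (∑-zero n λ k → f≡0 (suc k) λ ())) (ℤₚ.+-identityʳ (f zero))
∑-single (suc n) f (suc t) f≡0 =
  trans (cong (_+ ∑ n (f ∘ suc)) (f≡0 zero λ ()))
        (trans (ℤₚ.+-identityˡ (∑ n (f ∘ suc)))
               (∑-single n (f ∘ suc) t λ k k≢t → f≡0 (suc k) (k≢t ∘ suc-injective)))

∑-punchIn-antisym : ∀ n (g : Fin (suc n) → Fin (suc n) → ℤ) → (∀ a b → g a b ≡ - g b a) →
  ∑ (suc n) (λ j → ∑ n (λ k → g j (punchIn j k))) ≡ + 0
∑-punchIn-antisym zero    g anti = refl
∑-punchIn-antisym (suc n) g anti = begin
    row₀ + ∑ (suc n) (λ j → g (suc j) zero + inner j)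
  ≡⟨ cong (_+_ row₀) (∑-distrib-+ (suc n) (λ j → g (suc j) zero) inner) ⟩
    row₀ + (col₀ + ∑ (suc n) inner)
  ≡⟨ cong (λ x → row₀ + (col₀ + x))
          (∑-punchIn-antisym n (λ a b → g (suc a) (suc b)) (λ a b → anti (suc a) (suc b))) ⟩
    row₀ + (col₀ + + 0)
  ≡⟨ cong (_+_ row₀) (ℤₚ.+-identityʳ col₀) ⟩
    row₀ + col₀
  ≡⟨ sym (∑-distrib-+ (suc n) (λ k → g zero (suc k)) (λ k → g (suc k) zero)) ⟩
    ∑ (suc n) (λ k → g zero (suc k) + g (suc k) zero)
  ≡⟨ ∑-zero (suc n) (λ k → trans (cong (_+_ (g zero (suc k))) (anti (suc k) zero))
                                 (ℤₚ.+-inverseʳ (g zero (suc k)))) ⟩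
    + 0 ∎
  where
  row₀ col₀ : ℤ
  row₀ = ∑ (suc n) (λ k → g zero (suc k))
  col₀ = ∑ (suc n) (λ j → g (suc j) zero)
  inner : Fin (suc n) → ℤ
  inner j = ∑ n (λ k → g (suc j) (suc (punchIn j k)))

∑-lastZero : ∀ N (f : ℕ → ℤ) → f N ≡ + 0 → ∑ (suc N) (f ∘ toℕ) ≡ ∑ N (f ∘ toℕ)
∑-lastZero zero    f fN≡0 = trans (ℤₚ.+-identityʳ (f 0)) fN≡0
∑-lastZero (suc N) f fN≡0 = cong (_+_ (f 0)) (∑-lastZero N (f ∘ suc) fN≡0)

∏ : (n : ℕ) → (Fin n → ℤ) → ℤ
∏ zero    f = + 1
∏ (suc n) f = f zero * ∏ n (f ∘ suc)

∏-cong : ∀ n {f g : Fin n → ℤ} → f ≗ g → ∏ n f ≡ ∏ n g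
∏-cong zero    f≗g = refl
∏-cong (suc n) f≗g = cong₂ _*_ (f≗g zero) (∏-cong n (f≗g ∘ suc))

∏-init-last : ∀ N (f : ℕ → ℤ) → ∏ (suc N) (f ∘ toℕ) ≡ ∏ N (f ∘ toℕ) * f N
∏-init-last zero    f = ℤₚ.*-comm (f 0) (+ 1)
∏-init-last (suc N) f =
  trans (cong (f 0 *_) (∏-init-last N (f ∘ suc))) (sym (ℤₚ.*-assoc (f 0) _ _))

-- Determinants by Laplace expansion

Matrix : ℕ → Set
Matrix n = Fin n → Fin n → ℤ

minor : ∀ {n} → Matrix (suc n) → Fin (suc n) → Matrix n
minor M j i k = M (suc i) (punchIn j k)

laplaceTerm : ∀ {n} → Matrix (suc n) → Fin (suc n) → ℤ
laplaceTerm {n} M j = sgn (toℕ j) * (M zero j * det n (minor M j))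

det-cong : ∀ n {M N : Matrix n} → (∀ i → M i ≗ N i) → det n M ≡ det n N
det-cong zero    M≗N = refl
det-cong (suc n) M≗N = ∑-cong (suc n) λ j →
  cong (sgn (toℕ j) *_) (cong₂ _*_ (M≗N zero j) (det-cong n λ i k → M≗N (suc i) (punchIn j k)))

laplaceTerm-zeroˡ : ∀ {n} (M : Matrix (suc n)) j → M zero j ≡ + 0 → laplaceTerm M j ≡ + 0
laplaceTerm-zeroˡ M j M₀ⱼ≡0 =
  trans (cong (λ x → sgn (toℕ j) * (x * det _ (minor M j))) M₀ⱼ≡0) (ℤₚ.*-zeroʳ (sgn (toℕ j)))

laplaceTerm-zeroʳ : ∀ {n} (M : Matrix (suc n)) j → det n (minor M j) ≡ + 0 → laplaceTerm M j ≡ + 0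
laplaceTerm-zeroʳ M j minor≡0 =
  trans (cong (λ d → sgn (toℕ j) * (M zero j * d)) minor≡0)
        (trans (cong (sgn (toℕ j) *_) (ℤₚ.*-zeroʳ (M zero j))) (ℤₚ.*-zeroʳ (sgn (toℕ j))))

det-zeroRow : ∀ n (M : Matrix n) t → (∀ j → M t j ≡ + 0) → det n M ≡ + 0
det-zeroRow (suc n) M zero    row≡0 = ∑-zero (suc n) λ j → laplaceTerm-zeroˡ M j (row≡0 j)
det-zeroRow (suc n) M (suc t) row≡0 = ∑-zero (suc n) λ j →
  laplaceTerm-zeroʳ M j (det-zeroRow n (minor M j) t (row≡0 ∘ punchIn j))

laplaceTerm-zeroColumn : ∀ n (M : Matrix (suc n)) → (∀ i → M i zero ≡ + 0) →
  ∀ j → laplaceTerm M j ≡ + 0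
laplaceTerm-zeroColumn n       M col≡0 zero    = laplaceTerm-zeroˡ M zero (col≡0 zero)
laplaceTerm-zeroColumn (suc n) M col≡0 (suc j) = laplaceTerm-zeroʳ M (suc j)
  (∑-zero (suc n) (laplaceTerm-zeroColumn n (minor M (suc j)) (col≡0 ∘ suc)))

UpperTriangular : ∀ {n} → Matrix n → Set
UpperTriangular U = ∀ i j → toℕ j < toℕ i → U i j ≡ + 0

det-upperTriangular : ∀ n (U : Matrix n) → UpperTriangular U → det n U ≡ ∏ n (λ i → U i i)
det-upperTriangular zero          U tri = refl
det-upperTriangular (suc zero)    U tri =
  trans (ℤₚ.+-identityʳ (+ 1 * (U zero zero * + 1))) (ℤₚ.*-identityˡ (U zero zero * + 1))
det-upperTriangular (suc (suc n)) U tri = begin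
    + 1 * (U zero zero * det (suc n) (minor U zero)) + ∑ (suc n) (laplaceTerm U ∘ suc)
  ≡⟨ cong₂ _+_ (ℤₚ.*-identityˡ (U zero zero * det (suc n) (minor U zero)))
               (∑-zero (suc n) offDiagonal) ⟩
    U zero zero * det (suc n) (minor U zero) + + 0
  ≡⟨ ℤₚ.+-identityʳ _ ⟩
    U zero zero * det (suc n) (minor U zero)
  ≡⟨ cong (U zero zero *_) (det-upperTriangular (suc n) (minor U zero) λ i j j<i →
       tri (suc i) (suc j) (s≤s j<i)) ⟩
    ∏ (suc (suc n)) (λ i → U i i) ∎
  where
  offDiagonal : ∀ j → laplaceTerm U (suc j) ≡ + 0
  offDiagonal j = laplaceTerm-zeroʳ U (suc j) (∑-zero (suc n)
    (laplaceTerm-zeroColumn n (minor U (suc j)) λ i → tri (suc i) zero (s≤s z≤n)))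

AgreeOffRow : ∀ {n} → Fin n → Matrix n → Matrix n → Set
AgreeOffRow t M N = ∀ i → i ≢ t → M i ≗ N i

minor-agree : ∀ {n} {t : Fin n} {M N : Matrix (suc n)} → AgreeOffRow (suc t) M N →
  ∀ j → AgreeOffRow t (minor M j) (minor N j)
minor-agree M≈N j i i≢t k = M≈N (suc i) (i≢t ∘ suc-injective) (punchIn j k)

setRow : ∀ {n} → Matrix n → Fin n → (Fin n → ℤ) → Matrix n
setRow M t u = updateAt M t (const u)

setRow-same : ∀ {n} (M : Matrix n) t u → setRow M t u t ≗ u
setRow-same M t u = cong-app (updateAt-updates t M)

setRow-other : ∀ {n} (M : Matrix n) {t} u {i} → i ≢ t → setRow M t u i ≗ M i
setRow-other M {t} u {i} i≢t = cong-app (updateAt-minimal i t M i≢t)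

setRow-self : ∀ {n} (M : Matrix n) t i → setRow M t (M t) i ≗ M i
setRow-self M t i = cong-app (updateAt-id-local t M refl i)

setRow-agree : ∀ {n} (M : Matrix n) t u v → AgreeOffRow t (setRow M t u) (setRow M t v)
setRow-agree M t u v i i≢t j = trans (setRow-other M u i≢t j) (sym (setRow-other M v i≢t j))

setRow-≗ : ∀ {n} {M N : Matrix n} {t u} → N t ≗ u → AgreeOffRow t N M →
  ∀ i → setRow M t u i ≗ N i
setRow-≗ {M = M} {t = t} {u} Nₜ≗u N≈M i with i ≟ t
... | yes refl = λ j → trans (setRow-same M i u j) (sym (Nₜ≗u j))
... | no i≢t   = λ j → trans (setRow-other M u i≢t j) (sym (N≈M i i≢t j))

setRow₂ : ∀ {n} → Matrix n → Fin n → Fin n → (Fin n → ℤ) → (Fin n → ℤ) → Matrix n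
setRow₂ M s t x y = setRow (setRow M t y) s x

setRow₂-fst : ∀ {n} (M : Matrix n) s t x y → setRow₂ M s t x y s ≗ x
setRow₂-fst M s t x y = setRow-same (setRow M t y) s x

setRow₂-snd : ∀ {n} (M : Matrix n) {s t} x y → t ≢ s → setRow₂ M s t x y t ≗ y
setRow₂-snd M {s} {t} x y t≢s j = trans (setRow-other _ x t≢s j) (setRow-same M t y j)

setRow₂-other : ∀ {n} (M : Matrix n) {s t} x y {i} → i ≢ s → i ≢ t → setRow₂ M s t x y i ≗ M i
setRow₂-other M x y i≢s i≢t j = trans (setRow-other _ x i≢s j) (setRow-other M y i≢t j)

setRow₂-self : ∀ {n} (M : Matrix n) s t i → setRow₂ M s t (M s) (M t) i ≗ M i
setRow₂-self M s t i with i ≟ s | i ≟ t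
... | yes refl | _        = setRow₂-fst M i t (M i) (M t)
... | no i≢s   | yes refl = setRow₂-snd M (M s) (M i) i≢s
... | no i≢s   | no i≢t   = setRow₂-other M (M s) (M t) i≢s i≢t

setRow₂-comm : ∀ {n} (M : Matrix n) {s t} x y → s ≢ t →
  ∀ i → setRow₂ M s t x y i ≗ setRow₂ M t s y x i
setRow₂-comm M {s} {t} x y s≢t i = cong-app (updateAt-commutes s t s≢t M i)

det-linear : ∀ n t c {M A B : Matrix n} → AgreeOffRow t A M → AgreeOffRow t B M →
  (∀ j → M t j ≡ c * A t j + B t j) → det n M ≡ c * det n A + det n B
det-linear (suc n) zero c {M} {A} {B} A≈M B≈M Mₜ =
  trans (∑-cong (suc n) term) (∑-linear (suc n) c (laplaceTerm A) (laplaceTerm B))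
  where
  distrib : ∀ σ c a b d → σ * ((c * a + b) * d) ≡ c * (σ * (a * d)) + σ * (b * d)
  distrib = solve-∀
  minor≡ : ∀ {N} → AgreeOffRow zero N M → ∀ j → det n (minor M j) ≡ det n (minor N j)
  minor≡ N≈M j = det-cong n λ i k → sym (N≈M (suc i) (λ ()) (punchIn j k))
  term : ∀ j → laplaceTerm M j ≡ c * laplaceTerm A j + laplaceTerm B j
  term j = begin
      σ * (M zero j * d)
    ≡⟨ cong (λ x → σ * (x * d)) (Mₜ j) ⟩
      σ * ((c * A zero j + B zero j) * d)
    ≡⟨ distrib σ c (A zero j) (B zero j) d ⟩
      c * (σ * (A zero j * d)) + σ * (B zero j * d)
    ≡⟨ cong₂ (λ a b → c * (σ * (A zero j * a)) + σ * (B zero j * b))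
             (minor≡ A≈M j) (minor≡ B≈M j) ⟩
      c * laplaceTerm A j + laplaceTerm B j ∎
    where
    σ d : ℤ
    σ = sgn (toℕ j)
    d = det n (minor M j)
det-linear (suc n) (suc t) c {M} {A} {B} A≈M B≈M Mₜ =
  trans (∑-cong (suc n) term) (∑-linear (suc n) c (laplaceTerm A) (laplaceTerm B))
  where
  distrib : ∀ σ m c a b → σ * (m * (c * a + b)) ≡ c * (σ * (m * a)) + σ * (m * b)
  distrib = solve-∀
  term : ∀ j → laplaceTerm M j ≡ c * laplaceTerm A j + laplaceTerm B j
  term j = begin
      σ * (M zero j * det n (minor M j))
    ≡⟨ cong (λ d → σ * (M zero j * d))
            (det-linear n t c (minor-agree A≈M j) (minor-agree B≈M j) (Mₜ ∘ punchIn j)) ⟩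
      σ * (M zero j * (c * a + b))
    ≡⟨ distrib σ (M zero j) c a b ⟩
      c * (σ * (M zero j * a)) + σ * (M zero j * b)
    ≡⟨ cong₂ (λ x y → c * (σ * (x * a)) + σ * (y * b))
             (sym (A≈M zero (λ ()) j)) (sym (B≈M zero (λ ()) j)) ⟩
      c * laplaceTerm A j + laplaceTerm B j ∎
    where
    σ a b : ℤ
    σ = sgn (toℕ j)
    a = det n (minor A j)
    b = det n (minor B j)

det-setRow-linear : ∀ n (M : Matrix n) t c u v →
  det n (setRow M t (λ j → c * u j + v j)) ≡ c * det n (setRow M t u) + det n (setRow M t v)
det-setRow-linear n M t c u v = det-linear n t c (setRow-agree M t u _) (setRow-agree M t v _) λ j →
  trans (setRow-same M t _ j) (sym (cong₂ (λ a b → c * a + b) (setRow-same M t u j) (setRow-same M t v j)))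

det-setRow-additive : ∀ n (M : Matrix n) t u v →
  det n (setRow M t (zipWith _+_ u v)) ≡ det n (setRow M t u) + det n (setRow M t v)
det-setRow-additive n M t u v = begin
    det n (setRow M t (zipWith _+_ u v))
  ≡⟨ det-linear n t (+ 1) (setRow-agree M t u _) (setRow-agree M t v _) (λ j →
       trans (setRow-same M t _ j)
             (sym (trans (cong₂ (λ a b → + 1 * a + b) (setRow-same M t u j) (setRow-same M t v j))
                         (cong (_+ v j) (ℤₚ.*-identityˡ (u j)))))) ⟩
    + 1 * det n (setRow M t u) + det n (setRow M t v)
  ≡⟨ cong (_+ det n (setRow M t v)) (ℤₚ.*-identityˡ (det n (setRow M t u))) ⟩
    det n (setRow M t u) + det n (setRow M t v) ∎

det-setRow-∑ : ∀ n (M : Matrix n) t {m} (c : Fin m → ℤ) (W : Fin m → Fin n → ℤ) →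
  det n (setRow M t (λ j → ∑ m (λ k → c k * W k j))) ≡ ∑ m (λ k → c k * det n (setRow M t (W k)))
det-setRow-∑ n M t {zero}  c W = det-zeroRow n _ t (setRow-same M t _)
det-setRow-∑ n M t {suc m} c W =
  trans (det-setRow-linear n M t (c zero) (W zero) _)
        (cong (_+_ (c zero * det n (setRow M t (W zero)))) (det-setRow-∑ n M t (c ∘ suc) (W ∘ suc)))

-- Alternation

-- For a ≢ b, the increasing enumeration of Fin (2 + n) without a and b.
punchIn₂ : ∀ {n} → Fin (suc (suc n)) → Fin (suc (suc n)) → Fin n → Fin (suc (suc n))
punchIn₂         zero    zero    l       = suc (suc l)
punchIn₂         zero    (suc b) l       = suc (punchIn b l)
punchIn₂         (suc a) zero    l       = suc (punchIn a l)
punchIn₂ {suc n} (suc a) (suc b) zero    = zero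
punchIn₂ {suc n} (suc a) (suc b) (suc l) = suc (punchIn₂ a b l)

punchIn₂-comm : ∀ {n} (a b : Fin (suc (suc n))) l → punchIn₂ a b l ≡ punchIn₂ b a l
punchIn₂-comm         zero    zero    l       = refl
punchIn₂-comm         zero    (suc b) l       = refl
punchIn₂-comm         (suc a) zero    l       = refl
punchIn₂-comm {suc n} (suc a) (suc b) zero    = refl
punchIn₂-comm {suc n} (suc a) (suc b) (suc l) = cong suc (punchIn₂-comm a b l)

punchIn-punchIn : ∀ {n} (j : Fin (suc (suc n))) k l →
  punchIn j (punchIn k l) ≡ punchIn₂ j (punchIn j k) l
punchIn-punchIn         zero    k       l       = refl
punchIn-punchIn         (suc j) zero    l       = refl
punchIn-punchIn {suc n} (suc j) (suc k) zero    = refl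
punchIn-punchIn {suc n} (suc j) (suc k) (suc l) = cong suc (punchIn-punchIn j k l)

-- The sign with which the double expansion along rows 0 and 1 takes column a from row 0
-- and column b from row 1.
sgn₂ : ∀ {n} → Fin (suc n) → Fin (suc n) → ℤ
sgn₂         zero    zero    = + 0
sgn₂         zero    (suc b) = sgn (toℕ b)
sgn₂         (suc a) zero    = - sgn (toℕ a)
sgn₂ {suc n} (suc a) (suc b) = sgn₂ a b

sgn₂-antisym : ∀ {n} (a b : Fin (suc n)) → sgn₂ a b ≡ - sgn₂ b a
sgn₂-antisym         zero    zero    = refl
sgn₂-antisym         zero    (suc b) = sym (ℤₚ.neg-involutive _)
sgn₂-antisym         (suc a) zero    = refl
sgn₂-antisym {suc n} (suc a) (suc b) = sgn₂-antisym a b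

sgn*sgn≡sgn₂ : ∀ {n} (j : Fin (suc n)) k → sgn (toℕ j) * sgn (toℕ k) ≡ sgn₂ j (punchIn j k)
sgn*sgn≡sgn₂ zero    k       = ℤₚ.*-identityˡ _
sgn*sgn≡sgn₂ (suc j) zero    = ℤₚ.*-identityʳ _
sgn*sgn≡sgn₂ (suc j) (suc k) = trans (neg*neg (sgn (toℕ j)) (sgn (toℕ k))) (sgn*sgn≡sgn₂ j k)
  where
  neg*neg : ∀ a b → - a * - b ≡ a * b
  neg*neg = solve-∀

det-rows₀₁-equal : ∀ n (M : Matrix (suc (suc n))) → M zero ≗ M (suc zero) →
  det (suc (suc n)) M ≡ + 0
det-rows₀₁-equal n M row₀≗row₁ =
  trans (∑-cong (suc (suc n)) expand) (∑-punchIn-antisym (suc n) g g-antisym)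
  where
  R : Fin (suc (suc n)) → Fin (suc (suc n)) → ℤ
  R a b = det n (λ i l → M (suc (suc i)) (punchIn₂ a b l))

  g : Fin (suc (suc n)) → Fin (suc (suc n)) → ℤ
  g a b = sgn₂ a b * (M zero a * (M zero b * R a b))

  exchange : ∀ σ x y r → - σ * (x * (y * r)) ≡ - (σ * (y * (x * r)))
  exchange = solve-∀

  g-antisym : ∀ a b → g a b ≡ - g b a
  g-antisym a b = begin
      sgn₂ a b * (M zero a * (M zero b * R a b))
    ≡⟨ cong₂ (λ σ r → σ * (M zero a * (M zero b * r))) (sgn₂-antisym a b)
             (det-cong n λ i l → cong (M (suc (suc i))) (punchIn₂-comm a b l)) ⟩
      - sgn₂ b a * (M zero a * (M zero b * R b a))
    ≡⟨ exchange (sgn₂ b a) (M zero a) (M zero b) (R b a) ⟩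
      - g b a ∎

  regroup : ∀ σ x τ y d → (σ * x) * (τ * (y * d)) ≡ (σ * τ) * (x * (y * d))
  regroup = solve-∀

  expand : ∀ j → laplaceTerm M j ≡ ∑ (suc n) (λ k → g j (punchIn j k))
  expand j = begin
      sgn (toℕ j) * (M zero j * det (suc n) (minor M j))
    ≡⟨ sym (ℤₚ.*-assoc (sgn (toℕ j)) (M zero j) _) ⟩
      (sgn (toℕ j) * M zero j) * ∑ (suc n) (laplaceTerm (minor M j))
    ≡⟨ *-distribˡ-∑ (suc n) (sgn (toℕ j) * M zero j) (laplaceTerm (minor M j)) ⟩
      ∑ (suc n) (λ k → (sgn (toℕ j) * M zero j) * laplaceTerm (minor M j) k)
    ≡⟨ ∑-cong (suc n) term ⟩
      ∑ (suc n) (λ k → g j (punchIn j k)) ∎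
    where
    term : ∀ k → (sgn (toℕ j) * M zero j) * laplaceTerm (minor M j) k ≡ g j (punchIn j k)
    term k = trans (regroup (sgn (toℕ j)) (M zero j) (sgn (toℕ k)) (M (suc zero) (punchIn j k))
                            (det n (minor (minor M j) k)))
      (cong₂ (λ σ y → σ * (M zero j * y)) (sgn*sgn≡sgn₂ j k)
             (cong₂ _*_ (sym (row₀≗row₁ (punchIn j k)))
                        (det-cong n λ i l → cong (M (suc (suc i))) (punchIn-punchIn j k l))))

alternating⇒antisymmetric : ∀ {V : Set} (_⊕_ : V → V → V) (B : V → V → ℤ) →
  (∀ x x′ y → B (x ⊕ x′) y ≡ B x y + B x′ y) →
  (∀ x y y′ → B x (y ⊕ y′) ≡ B x y + B x y′) →
  (∀ x → B x x ≡ + 0) → ∀ x y → B y x ≡ - B x y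
alternating⇒antisymmetric _⊕_ B additiveˡ additiveʳ alternating x y =
  inverseʳ-unique (B x y) (B y x) (begin
      B x y + B y x
    ≡⟨ sym (cong₂ _+_ (ℤₚ.+-identityˡ (B x y)) (ℤₚ.+-identityʳ (B y x))) ⟩
      (+ 0 + B x y) + (B y x + + 0)
    ≡⟨ sym (cong₂ (λ a b → (a + B x y) + (B y x + b)) (alternating x) (alternating y)) ⟩
      (B x x + B x y) + (B y x + B y y)
    ≡⟨ sym (cong₂ _+_ (additiveʳ x x y) (additiveʳ y x y)) ⟩
      B x (x ⊕ y) + B y (x ⊕ y)
    ≡⟨ sym (additiveˡ x y (x ⊕ y)) ⟩
      B (x ⊕ y) (x ⊕ y)
    ≡⟨ alternating (x ⊕ y) ⟩
      + 0 ∎)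

det-setRow₂-swap : ∀ n (M : Matrix n) s t → s ≢ t → (∀ x → det n (setRow₂ M s t x x) ≡ + 0) →
  ∀ x y → det n (setRow₂ M s t y x) ≡ - det n (setRow₂ M s t x y)
det-setRow₂-swap n M s t s≢t alternating =
  alternating⇒antisymmetric (zipWith _+_) B additiveˡ additiveʳ alternating
  where
  B : (Fin n → ℤ) → (Fin n → ℤ) → ℤ
  B x y = det n (setRow₂ M s t x y)
  comm : ∀ x y → B x y ≡ det n (setRow₂ M t s y x)
  comm x y = det-cong n (setRow₂-comm M x y s≢t)
  additiveˡ : ∀ x x′ y → B (zipWith _+_ x x′) y ≡ B x y + B x′ y
  additiveˡ x x′ y = det-setRow-additive n (setRow M t y) s x x′
  additiveʳ : ∀ x y y′ → B x (zipWith _+_ y y′) ≡ B x y + B x y′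
  additiveʳ x y y′ =
    trans (comm x (zipWith _+_ y y′))
          (trans (det-setRow-additive n (setRow M s x) t y y′) (sym (cong₂ _+_ (comm x y) (comm x y′))))

Alternating : ℕ → Set
Alternating n = ∀ (M : Matrix n) s t → s ≢ t → M s ≗ M t → det n M ≡ + 0

det-rows-suc-equal : ∀ {n} → Alternating n → ∀ (M : Matrix (suc n)) s t → s ≢ t →
  M (suc s) ≗ M (suc t) → det (suc n) M ≡ + 0
det-rows-suc-equal alternating M s t s≢t rows≗ = ∑-zero _ λ j →
  laplaceTerm-zeroʳ M j (alternating (minor M j) s t s≢t (rows≗ ∘ punchIn j))

-- Rows 1 and t ≥ 2 lie in every minor, so exchanging them negates the determinant; after the
-- exchange rows 0 and 1 are equal.
det-rows₀-equal : ∀ {n} → Alternating n → ∀ (M : Matrix (suc n)) t → M zero ≗ M (suc t) →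
  det (suc n) M ≡ + 0
det-rows₀-equal {suc n} alternating M zero    row₀≗row₁ = det-rows₀₁-equal n M row₀≗row₁
det-rows₀-equal {suc n} alternating M (suc t) row₀≗rowₜ = begin
    det (suc (suc n)) M
  ≡⟨ sym (det-cong (suc (suc n)) (setRow₂-self M r₁ rₜ)) ⟩
    det (suc (suc n)) (setRow₂ M r₁ rₜ (M r₁) (M rₜ))
  ≡⟨ det-setRow₂-swap (suc (suc n)) M r₁ rₜ (λ ()) rows₁ₜ-alternating (M rₜ) (M r₁) ⟩
    - det (suc (suc n)) (setRow₂ M r₁ rₜ (M rₜ) (M r₁))
  ≡⟨ cong -_ (det-rows₀₁-equal n (setRow₂ M r₁ rₜ (M rₜ) (M r₁)) λ j →
       trans (setRow₂-other M {r₁} {rₜ} (M rₜ) (M r₁) {zero} (λ ()) (λ ()) j)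
             (trans (row₀≗rowₜ j) (sym (setRow₂-fst M r₁ rₜ (M rₜ) (M r₁) j)))) ⟩
    + 0 ∎
  where
  r₁ rₜ : Fin (suc (suc n))
  r₁ = suc zero
  rₜ = suc (suc t)
  rows₁ₜ-alternating : ∀ x → det (suc (suc n)) (setRow₂ M r₁ rₜ x x) ≡ + 0
  rows₁ₜ-alternating x =
    det-rows-suc-equal alternating (setRow₂ M r₁ rₜ x x) zero (suc t) (λ ()) λ j →
      trans (setRow₂-fst M r₁ rₜ x x j) (sym (setRow₂-snd M {r₁} {rₜ} x x (λ ()) j))

det-alternating : ∀ n → Alternating n
det-alternating (suc n) M zero    zero    0≢0 _     = contradiction refl 0≢0
det-alternating (suc n) M zero    (suc t) _   rows≗ = det-rows₀-equal (det-alternating n) M t rows≗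
det-alternating (suc n) M (suc s) zero    _   rows≗ =
  det-rows₀-equal (det-alternating n) M s (sym ∘ rows≗)
det-alternating (suc n) M (suc s) (suc t) s≢t rows≗ =
  det-rows-suc-equal (det-alternating n) M s t (s≢t ∘ cong suc) rows≗

-- Row reduction

det-addRowCombination : ∀ n (M M′ : Matrix n) t (c : Fin n → ℤ) → c t ≡ + 1 →
  AgreeOffRow t M′ M → (∀ j → M′ t j ≡ ∑ n (λ k → c k * M k j)) → det n M′ ≡ det n M
det-addRowCombination n M M′ t c cₜ≡1 M′≈M M′ₜ = begin
    det n M′
  ≡⟨ sym (det-cong n (setRow-≗ M′ₜ M′≈M)) ⟩
    det n (setRow M t (λ j → ∑ n (λ k → c k * M k j)))
  ≡⟨ det-setRow-∑ n M t c M ⟩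
    ∑ n (λ k → c k * det n (setRow M t (M k)))
  ≡⟨ ∑-single n _ t (λ k k≢t → trans (cong (c k *_) (repeated k k≢t)) (ℤₚ.*-zeroʳ (c k))) ⟩
    c t * det n (setRow M t (M t))
  ≡⟨ cong₂ _*_ cₜ≡1 (det-cong n (setRow-self M t)) ⟩
    + 1 * det n M
  ≡⟨ ℤₚ.*-identityˡ (det n M) ⟩
    det n M ∎
  where
  repeated : ∀ k → k ≢ t → det n (setRow M t (M k)) ≡ + 0
  repeated k k≢t = det-alternating n _ k t k≢t λ j →
    trans (setRow-other M (M k) k≢t j) (sym (setRow-same M t (M k) j))

_*ᴹ_ : ∀ {n} → Matrix n → Matrix n → Matrix n
_*ᴹ_ {n} C M i j = ∑ n (λ k → C i k * M k j)

module RowReduction {n} (C M : Matrix n)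
  (C-diag : ∀ i → C i i ≡ + 1) (C-above : ∀ i k → toℕ i < toℕ k → C i k ≡ + 0) where

  partial : ℕ → Matrix n
  partial t i with toℕ i <? t
  ... | yes _ = M i
  ... | no  _ = (C *ᴹ M) i

  partial-below : ∀ {t} i → toℕ i < t → partial t i ≗ M i
  partial-below {t} i i<t with toℕ i <? t
  ... | yes _   = λ _ → refl
  ... | no  i≮t = contradiction i<t i≮t

  partial-from : ∀ {t} i → ¬ toℕ i < t → partial t i ≗ (C *ᴹ M) i
  partial-from {t} i i≮t with toℕ i <? t
  ... | yes i<t = contradiction i<t i≮t
  ... | no  _   = λ _ → refl

  -- Row t of C *ᴹ M is row t of M plus multiples of the rows k < t of M, and those rows are
  -- already rows of partial (suc t).
  det-partial-step : ∀ t → t < n → det n (partial t) ≡ det n (partial (suc t))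
  det-partial-step t t<n =
    det-addRowCombination n (partial (suc t)) (partial t) T (C T) (C-diag T) agree rowₜ
    where
    T : Fin n
    T = fromℕ< t<n
    T≡t : toℕ T ≡ t
    T≡t = toℕ-fromℕ< t<n
    agree : AgreeOffRow T (partial t) (partial (suc t))
    agree i i≢T j with ℕₚ.<-cmp (toℕ i) t
    ... | tri< i<t _ _ = trans (partial-below i i<t j) (sym (partial-below i (ℕₚ.m<n⇒m<1+n i<t) j))
    ... | tri≈ _ i≡t _ = contradiction (toℕ-injective (trans i≡t (sym T≡t))) i≢T
    ... | tri> _ _ t<i = trans (partial-from i (ℕₚ.<-asym t<i) j)
                               (sym (partial-from {suc t} i (ℕₚ.<⇒≱ t<i ∘ ℕₚ.m<1+n⇒m≤n) j))
    column : ∀ j k → C T k * M k j ≡ C T k * partial (suc t) k j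
    column j k with ℕₚ.≤-<-connex (toℕ k) t
    ... | inj₁ k≤t = cong (C T k *_) (sym (partial-below k (s≤s k≤t) j))
    ... | inj₂ t<k = trans (cong (_* M k j) Cₜₖ≡0) (sym (cong (_* partial (suc t) k j) Cₜₖ≡0))
      where
      Cₜₖ≡0 : C T k ≡ + 0
      Cₜₖ≡0 = C-above T k (subst (_< toℕ k) (sym T≡t) t<k)
    rowₜ : ∀ j → partial t T j ≡ ∑ n (λ k → C T k * partial (suc t) k j)
    rowₜ j = trans (partial-from T (ℕₚ.<-irrefl T≡t) j) (∑-cong n (column j))

  det-partial : ∀ t → t ℕ.≤ n → det n (partial 0) ≡ det n (partial t)
  det-partial zero    _   = refl
  det-partial (suc t) t<n = trans (det-partial t (ℕₚ.<⇒≤ t<n)) (det-partial-step t t<n)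

  det-*ᴹ-lowerUnitriangular : det n (C *ᴹ M) ≡ det n M
  det-*ᴹ-lowerUnitriangular = begin
      det n (C *ᴹ M)
    ≡⟨ sym (det-cong n λ i → partial-from {0} i λ ()) ⟩
      det n (partial 0)
    ≡⟨ det-partial n ℕₚ.≤-refl ⟩
      det n (partial n)
    ≡⟨ det-cong n (λ i → partial-below i (toℕ<n i)) ⟩
      det n M ∎

open RowReduction using (det-*ᴹ-lowerUnitriangular)

-- Stieltjes tables

shiftRight : (ℕ → ℤ) → ℕ → ℤ
shiftRight f zero    = + 0
shiftRight f (suc k) = f k

+-double-suc : ∀ k t → k ℕ.+ 2 ℕ.* suc t ≡ suc (suc k) ℕ.+ 2 ℕ.* t
+-double-suc = ℕ-Ring.solve-∀

module StieltjesTable (α : ℕ → ℤ) where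

  L : ℕ → ℕ → ℤ
  L zero    zero    = + 1
  L zero    (suc k) = + 0
  L (suc i) k       = shiftRight (L i) k + α k * L i (suc k)

  D : ℕ → ℤ
  D zero    = + 1
  D (suc k) = α k * D k

  L-suc≡0 : ∀ i k → shiftRight (L i) k ≡ + 0 → L i (suc k) ≡ + 0 → L (suc i) k ≡ + 0
  L-suc≡0 i k left≡0 right≡0 =
    trans (cong₂ (λ a b → a + α k * b) left≡0 right≡0) (cong (_+_ (+ 0)) (ℤₚ.*-zeroʳ (α k)))

  L-above : ∀ i k → i < k → L i k ≡ + 0
  L-above zero    (suc k) _         = refl
  L-above (suc i) (suc k) (s≤s i<k) =
    L-suc≡0 i (suc k) (L-above i k i<k) (L-above i (suc (suc k)) (ℕₚ.m<n⇒m<1+n (ℕₚ.m<n⇒m<1+n i<k)))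

  L-diag : ∀ i → L i i ≡ + 1
  L-diag zero    = refl
  L-diag (suc i) =
    trans (cong₂ (λ a b → a + α (suc i) * b)
                 (L-diag i) (L-above i (suc (suc i)) (ℕₚ.m<n⇒m<1+n ℕₚ.≤-refl)))
          (cong (_+_ (+ 1)) (ℤₚ.*-zeroʳ (α (suc i))))

  L-subdiag : ∀ k → L (suc k) k ≡ + 0
  L-subdiag zero    = L-suc≡0 0 0 refl refl
  L-subdiag (suc k) = L-suc≡0 (suc k) (suc k) (L-subdiag k) (L-above (suc k) (suc (suc k)) ℕₚ.≤-refl)

  L-odd : ∀ t k → L (suc (k ℕ.+ 2 ℕ.* t)) k ≡ + 0
  L-odd zero    k       = subst (λ m → L (suc m) k ≡ + 0) (sym (ℕₚ.+-identityʳ k)) (L-subdiag k)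
  L-odd (suc t) zero    =
    L-suc≡0 (2 ℕ.* suc t) 0 refl (trans (cong (λ m → L m 1) (ℕₚ.*-suc 2 t)) (L-odd t 1))
  L-odd (suc t) (suc k) = L-suc≡0 (suc (k ℕ.+ 2 ℕ.* suc t)) (suc k) (L-odd (suc t) k)
    (trans (cong (λ m → L (suc m) (suc (suc k))) (+-double-suc k t)) (L-odd t (suc (suc k))))

  LDLᵀ : ℕ → ℕ → ℕ → ℤ
  LDLᵀ N i j = ∑ N (λ k → L i (toℕ k) * (D (toℕ k) * L j (toℕ k)))

  -- Expanding L (suc i), resp. L (suc j), by the recurrence splits both sides into the same two
  -- sums, up to terms at k = N that vanish because L i is zero beyond the diagonal.
  LDLᵀ-shift : ∀ N i j → i < N → LDLᵀ (suc N) (suc i) j ≡ LDLᵀ (suc N) i (suc j)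
  LDLᵀ-shift N i j i<N =
    trans expandˡ (trans (ℤₚ.+-comm (∑ N (P ∘ toℕ)) (∑ N (Q ∘ toℕ))) (sym expandʳ))
    where
    P Q lowerˡ lowerʳ : ℕ → ℤ
    P k = L i k * (D (suc k) * L j (suc k))
    Q k = L i (suc k) * (D (suc k) * L j k)
    lowerˡ k = shiftRight (L i) k * (D k * L j k)
    lowerʳ k = L i k * (D k * shiftRight (L j) k)

    splitˡ : ∀ a c b d l → (a + c * b) * (d * l) ≡ a * (d * l) + b * ((c * d) * l)
    splitˡ = solve-∀
    splitʳ : ∀ l d a c b → l * (d * (a + c * b)) ≡ l * (d * a) + l * ((c * d) * b)
    splitʳ = solve-∀

    expandˡ : LDLᵀ (suc N) (suc i) j ≡ ∑ N (P ∘ toℕ) + ∑ N (Q ∘ toℕ)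
    expandˡ = begin
        LDLᵀ (suc N) (suc i) j
      ≡⟨ ∑-cong (suc N) (λ k → splitˡ (shiftRight (L i) (toℕ k)) (α (toℕ k)) (L i (suc (toℕ k)))
                                      (D (toℕ k)) (L j (toℕ k))) ⟩
        ∑ (suc N) (λ k → lowerˡ (toℕ k) + Q (toℕ k))
      ≡⟨ ∑-distrib-+ (suc N) (lowerˡ ∘ toℕ) (Q ∘ toℕ) ⟩
        (+ 0 + ∑ N (P ∘ toℕ)) + ∑ (suc N) (Q ∘ toℕ)
      ≡⟨ cong₂ _+_ (ℤₚ.+-identityˡ (∑ N (P ∘ toℕ)))
                   (∑-lastZero N Q (cong (_* (D (suc N) * L j N))
                                         (L-above i (suc N) (ℕₚ.m<n⇒m<1+n i<N)))) ⟩
        ∑ N (P ∘ toℕ) + ∑ N (Q ∘ toℕ) ∎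

    expandʳ : LDLᵀ (suc N) i (suc j) ≡ ∑ N (Q ∘ toℕ) + ∑ N (P ∘ toℕ)
    expandʳ = begin
        LDLᵀ (suc N) i (suc j)
      ≡⟨ ∑-cong (suc N) (λ k → splitʳ (L i (toℕ k)) (D (toℕ k)) (shiftRight (L j) (toℕ k))
                                      (α (toℕ k)) (L j (suc (toℕ k)))) ⟩
        ∑ (suc N) (λ k → lowerʳ (toℕ k) + P (toℕ k))
      ≡⟨ ∑-distrib-+ (suc N) (lowerʳ ∘ toℕ) (P ∘ toℕ) ⟩
        (L i 0 * + 0 + ∑ N (Q ∘ toℕ)) + ∑ (suc N) (P ∘ toℕ)
      ≡⟨ cong₂ _+_ (trans (cong (_+ ∑ N (Q ∘ toℕ)) (ℤₚ.*-zeroʳ (L i 0)))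
                          (ℤₚ.+-identityˡ (∑ N (Q ∘ toℕ))))
                   (∑-lastZero N P (cong (_* (D (suc N) * L j (suc N))) (L-above i N i<N))) ⟩
        ∑ N (Q ∘ toℕ) + ∑ N (P ∘ toℕ) ∎

  LDLᵀ≡L : ∀ N i j → i < N → LDLᵀ N i j ≡ L (i ℕ.+ j) 0
  LDLᵀ≡L (suc N) zero    j _         =
    trans (cong₂ _+_ (trans (ℤₚ.*-identityˡ _) (ℤₚ.*-identityˡ (L j 0))) (∑-zero N λ _ → refl))
          (ℤₚ.+-identityʳ (L j 0))
  LDLᵀ≡L (suc N) (suc i) j (s≤s i<N) =
    trans (LDLᵀ-shift N i j i<N)
          (trans (LDLᵀ≡L (suc N) i (suc j) (ℕₚ.m<n⇒m<1+n i<N))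
                 (cong (λ m → L m 0) (ℕₚ.+-suc i j)))

  hankel-L₀ : ∀ n → hankel (λ m → L m 0) n ≡ ∏ (suc n) (D ∘ toℕ)
  hankel-L₀ n = begin
      hankel (λ m → L m 0) n
    ≡⟨ det-cong (suc n) (λ i j → sym (LDLᵀ≡L (suc n) (toℕ i) (toℕ j) (toℕ<n i))) ⟩
      det (suc n) (Lᴹ *ᴹ DLᵀ)
    ≡⟨ det-*ᴹ-lowerUnitriangular Lᴹ DLᵀ (L-diag ∘ toℕ) (λ i k → L-above (toℕ i) (toℕ k)) ⟩
      det (suc n) DLᵀ
    ≡⟨ det-upperTriangular (suc n) DLᵀ (λ k j j<k →
         trans (cong (D (toℕ k) *_) (L-above (toℕ j) (toℕ k) j<k)) (ℤₚ.*-zeroʳ (D (toℕ k)))) ⟩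
      ∏ (suc n) (λ k → D (toℕ k) * L (toℕ k) (toℕ k))
    ≡⟨ ∏-cong (suc n) (λ k →
         trans (cong (D (toℕ k) *_) (L-diag (toℕ k))) (ℤₚ.*-identityʳ (D (toℕ k)))) ⟩
      ∏ (suc n) (D ∘ toℕ) ∎
    where
    Lᴹ DLᵀ : Matrix (suc n)
    Lᴹ i k = L (toℕ i) (toℕ k)
    DLᵀ k j = D (toℕ k) * L (toℕ j) (toℕ k)

-- The Bessel table

2[1+t]C[1+t]≡[1+2t]Ct+[1+2t]Ct : ∀ t →
  (2 ℕ.* suc t) C suc t ≡ (1 ℕ.+ 2 ℕ.* t) C t ℕ.+ (1 ℕ.+ 2 ℕ.* t) C t
2[1+t]C[1+t]≡[1+2t]Ct+[1+2t]Ct t = begin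
    (2 ℕ.* suc t) C suc t
  ≡⟨ cong (_C suc t) (ℕₚ.*-suc 2 t) ⟩
    suc (1 ℕ.+ 2 ℕ.* t) C suc t
  ≡⟨ sym (nCk+nC[k+1]≡[n+1]C[k+1] (1 ℕ.+ 2 ℕ.* t) t) ⟩
    (1 ℕ.+ 2 ℕ.* t) C t ℕ.+ (1 ℕ.+ 2 ℕ.* t) C suc t
  ≡⟨ cong ((1 ℕ.+ 2 ℕ.* t) C t ℕ.+_)
          (trans (nCk≡nC[n∸k] 1+t≤1+2t) (cong ((1 ℕ.+ 2 ℕ.* t) C_) 1+2t∸[1+t]≡t)) ⟩
    (1 ℕ.+ 2 ℕ.* t) C t ℕ.+ (1 ℕ.+ 2 ℕ.* t) C t ∎
  where
  1+t≤1+2t : suc t ℕ.≤ 1 ℕ.+ 2 ℕ.* t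
  1+t≤1+2t = s≤s (ℕₚ.m≤n*m t 2)
  1+2t∸[1+t]≡t : (1 ℕ.+ 2 ℕ.* t) ℕ.∸ suc t ≡ t
  1+2t∸[1+t]≡t = trans (cong (λ x → (t ℕ.+ x) ℕ.∸ t) (ℕₚ.+-identityʳ t)) (ℕₚ.m+n∸m≡n t t)

besselCoefficient : ℤ → ℕ → ℤ
besselCoefficient r zero    = + 2 * r
besselCoefficient r (suc _) = r

module BesselTable (r : ℤ) where
  open StieltjesTable (besselCoefficient r)

  L-even : ∀ t k → L (k ℕ.+ 2 ℕ.* t) k ≡ + ((k ℕ.+ 2 ℕ.* t) C t) * r ^ t
  L-even zero    k rewrite ℕₚ.+-identityʳ k = L-diag k
  L-even (suc t) zero    = begin
      L (2 ℕ.* suc t) 0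
    ≡⟨ cong (λ m → L m 0) (ℕₚ.*-suc 2 t) ⟩
      + 0 + (+ 2 * r) * L (1 ℕ.+ 2 ℕ.* t) 1
    ≡⟨ ℤₚ.+-identityˡ ((+ 2 * r) * L (1 ℕ.+ 2 ℕ.* t) 1) ⟩
      (+ 2 * r) * L (1 ℕ.+ 2 ℕ.* t) 1
    ≡⟨ cong ((+ 2 * r) *_) (L-even t 1) ⟩
      (+ 2 * r) * (+ c * r ^ t)
    ≡⟨ double (+ c) r (r ^ t) ⟩
      (+ c + + c) * r ^ suc t
    ≡⟨ cong (_* r ^ suc t) (trans (sym (ℤₚ.pos-+ c c))
                                  (cong +_ (sym (2[1+t]C[1+t]≡[1+2t]Ct+[1+2t]Ct t)))) ⟩
      + ((2 ℕ.* suc t) C suc t) * r ^ suc t ∎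
    where
    c : ℕ
    c = (1 ℕ.+ 2 ℕ.* t) C t
    double : ∀ c r p → (+ 2 * r) * (c * p) ≡ (c + c) * (r * p)
    double = solve-∀
  L-even (suc t) (suc k) = begin
      L n k + r * L n (suc (suc k))
    ≡⟨ cong₂ (λ a b → a + r * b) (L-even (suc t) k)
             (trans (cong (λ m → L m (suc (suc k))) (+-double-suc k t)) (L-even t (suc (suc k)))) ⟩
      + (n C suc t) * r ^ suc t + r * (+ ((suc (suc k) ℕ.+ 2 ℕ.* t) C t) * r ^ t)
    ≡⟨ cong (λ m → + (n C suc t) * r ^ suc t + r * (+ (m C t) * r ^ t)) (sym (+-double-suc k t)) ⟩
      + (n C suc t) * r ^ suc t + r * (+ (n C t) * r ^ t)
    ≡⟨ collect (+ (n C suc t)) (+ (n C t)) r (r ^ t) ⟩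
      (+ (n C t) + + (n C suc t)) * r ^ suc t
    ≡⟨ cong (_* r ^ suc t) (trans (sym (ℤₚ.pos-+ (n C t) (n C suc t)))
                                  (cong +_ (nCk+nC[k+1]≡[n+1]C[k+1] n t))) ⟩
      + (suc n C suc t) * r ^ suc t ∎
    where
    n : ℕ
    n = k ℕ.+ 2 ℕ.* suc t
    collect : ∀ a b r p → a * (r * p) + r * (b * p) ≡ (b + a) * (r * p)
    collect = solve-∀

  besselSeq≡L : ∀ n → besselSeq r n ≡ L n 0
  besselSeq≡L n with n % 2 | m%n<n n 2 | m≡m%n+[m/n]*n n 2
  ... | zero        | _            | n≡2q   =
    sym (trans (cong (λ m → L m 0) (trans n≡2q (ℕₚ.*-comm (n / 2) 2))) (L-even (n / 2) 0))
  ... | suc zero    | _            | n≡1+2q =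
    sym (trans (cong (λ m → L m 0) (trans n≡1+2q (cong suc (ℕₚ.*-comm (n / 2) 2)))) (L-odd (n / 2) 0))
  ... | suc (suc _) | s≤s (s≤s ()) | _

  D-suc : ∀ k → D (suc k) ≡ + 2 * r ^ suc k
  D-suc zero    = ℤₚ.*-assoc (+ 2) r (+ 1)
  D-suc (suc k) = trans (cong (r *_) (D-suc k)) (swap r (r ^ suc k))
    where
    swap : ∀ r p → r * (+ 2 * p) ≡ + 2 * (r * p)
    swap = solve-∀

  ∏-D : ∀ n → ∏ (suc n) (D ∘ toℕ) ≡ (+ 2) ^ n * r ^ (suc n C 2)
  ∏-D zero    = refl
  ∏-D (suc n) = begin
      ∏ (suc (suc n)) (D ∘ toℕ)
    ≡⟨ ∏-init-last (suc n) D ⟩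
      ∏ (suc n) (D ∘ toℕ) * D (suc n)
    ≡⟨ cong₂ _*_ (∏-D n) (D-suc n) ⟩
      ((+ 2) ^ n * r ^ (suc n C 2)) * (+ 2 * r ^ suc n)
    ≡⟨ regroup ((+ 2) ^ n) (r ^ (suc n C 2)) (r ^ suc n) ⟩
      (+ 2) ^ suc n * (r ^ suc n * r ^ (suc n C 2))
    ≡⟨ cong ((+ 2) ^ suc n *_) (sym (ℤₚ.^-distribˡ-+-* r (suc n) (suc n C 2))) ⟩
      (+ 2) ^ suc n * r ^ (suc n ℕ.+ suc n C 2)
    ≡⟨ cong (λ m → (+ 2) ^ suc n * r ^ (m ℕ.+ suc n C 2)) (sym (nC1≡n (suc n))) ⟩
      (+ 2) ^ suc n * r ^ (suc n C 1 ℕ.+ suc n C 2)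
    ≡⟨ cong (λ m → (+ 2) ^ suc n * r ^ m) (nCk+nC[k+1]≡[n+1]C[k+1] (suc n) 1) ⟩
      (+ 2) ^ suc n * r ^ (suc (suc n) C 2) ∎
    where
    regroup : ∀ a b c → (a * b) * (+ 2 * c) ≡ (+ 2 * a) * (c * b)
    regroup = solve-∀

hankel-cong : ∀ {a b : ℕ → ℤ} → a ≗ b → ∀ n → hankel a n ≡ hankel b n
hankel-cong a≗b n = det-cong (suc n) λ i j → a≗b (toℕ i ℕ.+ toℕ j)

mainTheorem2 : (r : ℤ) (n : ℕ) →
    hankel (besselSeq r) n ≡ ((+ 2) ^ n) * (r ^ (suc n C 2))
mainTheorem2 r n = begin
    hankel (besselSeq r) n
  ≡⟨ hankel-cong besselSeq≡L n ⟩
    hankel (λ m → L m 0) n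
  ≡⟨ hankel-L₀ n ⟩
    ∏ (suc n) (D ∘ toℕ)
  ≡⟨ ∏-D n ⟩
    (+ 2) ^ n * r ^ (suc n C 2) ∎
  where
  open StieltjesTable (besselCoefficient r)
  open BesselTable r
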